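{- (1) For all LNF-terms $M,N$, if $M\to N$ in LNF then $M\twoheadrightarrow N$ in $\lambda Q$ (reading $\mathsf{C}_v(V,x.N)$ as $\mathsf{C}(\uparrow V,x.N)$). (2) For all $\lambda Q$-terms $M,N$, if $M\to N$ in $\lambda Q$ then $M^{\triangledown}\twoheadrightarrow N^{\triangledown}$ in LNF. (3) For every $\lambda Q$-term $M$, $M\twoheadrightarrow M^{\triangledown}$ in $\lambda Q$. (4) For every LNF-term $M$, $M=M^{\triangledown}$.
   Context: Terms up to $\alpha$-equivalence; one-step reduction is the closure of the rules under all constructors; $\twoheadrightarrow$ its reflexive-transitive closure. In $y(V,z.N)$ and $x.N$ the variable before the dot is bound in the following term. $\lambda Q$: terms $M,N::=\uparrow V\mid x(V,y.N)\mid\mathsf{C}(M,x.N)$; values $V,W::=x\mid\lambda x.M$. Value substitution $[V/y]$: homomorphic and capture-avoiding ($[V/y]y=V$, $[V/y]z=z$ for $z\neq y$), except: $[V/y](y(W,x.P))=\mathsf{C}(\uparrow V,y'.y'([V/y]W,x.[V/y]P))$ with $y'$ fresh if $V$ is an abstraction, and $[x'/y](y(W,x.P))=x'([x'/y]W,x.[x'/y]P)$. Rules: $(B_v)$ $\mathsf{C}(\uparrow(\lambda x.M),y.y(V,z.N))\to\mathsf{C}(\mathsf{C}(\uparrow V,x.M),z.N)$ if $y\notin FV(V)\cup FV(N)$; $(\sigma_v)$ $\mathsf{C}(\uparrow V,y.N)\to[V/y]N$ if the redex is not a $B_v$-redex; $(\eta_{cut})$ $\mathsf{C}(M,x.\uparrow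 x)\to M$; $(\pi_1)$ $\mathsf{C}(z(V,y.P),x.N)\to z(V,y.\mathsf{C}(P,x.N))$; $(\pi_2)$ $\mathsf{C}(\mathsf{C}(M,y.P),x.N)\to\mathsf{C}(M,y.\mathsf{C}(P,x.N))$. LNF: terms $M,N::=\uparrow V\mid x(V,y.N)\mid\mathsf{C}_v(V,x.N)$; values $V,W::=x\mid\lambda x.M$; LNF-terms are seen as $\lambda Q$-terms via $\mathsf{C}_v(V,x.N)=\mathsf{C}(\uparrow V,x.N)$, and substitution $[V/y]$ in LNF is the $\lambda Q$ one read through this identification. Derived cut $\mathsf{C}_v(M:z.N)$: $\mathsf{C}_v(\uparrow V:z.N)=\mathsf{C}_v(V,z.N)$; $\mathsf{C}_v(x(V,y.M):z.N)=x(V,y.\mathsf{C}_v(M:z.N))$; $\mathsf{C}_v(\mathsf{C}_v(V,y.M):z.N)=\mathsf{C}_v(V,y.\mathsf{C}_v(M:z.N))$. Rules: $(B_v)$ $\mathsf{C}_v(\lambda x.M,y.y(V,z.N))\to\mathsf{C}_v(V,x.\mathsf{C}_v(M:z.N))$ if $y\notin FV(V)\cup FV(N)$; $(\sigma_v)$ $\mathsf{C}_v(V,y.N)\to[V/y]N$ if $B_v$ does not apply. Map $(\cdot)^{\triangledown}$ from $\lambda Q$ to LNF: $(\uparrow V)^{\triangledown}=\uparrow V^{\triangledown\triangledown}$; $(x(V,y.N))^{\triangledown}=x(V^{\triangledown\triangledown},y.N^{\triangledown})$; $(\mathsf{C}(M,y.N))^{\triangledown}=\mathsf{C}_v(M^{\triangledown}:y.N^{\triangledown})$;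 $x^{\triangledown\triangledown}=x$; $(\lambda x.M)^{\triangledown\triangledown}=\lambda x.M^{\triangledown}$. -}

module Defs where

-- Terms up to alpha-equivalence are represented by well-scoped de Bruijn
-- syntax: a term of type `Tm n` has its free variables among `Fin n`,
-- and each binder (`y.N`, `x.M`) extends the scope by one, the bound
-- variable being `zero`.

open import Data.Nat using (ℕ; zero; suc)
open import Data.Fin using (Fin; zero; suc)
open import Relation.Nullary using (¬_)
open import Relation.Binary.Construct.Closure.ReflexiveTransitive using (Star)

Ren : ℕ → ℕ → Set
Ren m n = Fin m → Fin n

liftR : ∀ {m n} → Ren m n → Ren (suc m) (suc n)
liftR ρ zero    = zero
liftR ρ (suc i) = suc (ρ i)

-- λQ syntax
--   M,N ::= ↑V | x(V,y.N) | C(M,x.N)      V,W ::= x | λx.M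

mutual
  data Tm (n : ℕ) : Set where
    up  : Val n → Tm n
    app : Fin n → Val n → Tm (suc n) → Tm n
    cut : Tm n → Tm (suc n) → Tm n

  data Val (n : ℕ) : Set where
    var : Fin n → Val n
    lam : Tm (suc n) → Val n

mutual
  renT : ∀ {m n} → Ren m n → Tm m → Tm n
  renT ρ (up V)      = up (renV ρ V)
  renT ρ (app x V N) = app (ρ x) (renV ρ V) (renT (liftR ρ) N)
  renT ρ (cut M N)   = cut (renT ρ M) (renT (liftR ρ) N)

  renV : ∀ {m n} → Ren m n → Val m → Val n
  renV ρ (var x) = var (ρ x)
  renV ρ (lam M) = lam (renT (liftR ρ) M)

Sub : ℕ → ℕ → Set
Sub m n = Fin m → Val n

liftS : ∀ {m n} → Sub m n → Sub (suc m) (suc n)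
liftS σ zero    = var zero
liftS σ (suc i) = renV suc (σ i)

-- the non-homomorphic clause: substituting into y(W, x.P), given the
-- value V substituted for the head y, and the already substituted W, P
subApp : ∀ {n} → Val n → Val n → Tm (suc n) → Tm n
subApp (var x') W P = app x' W P
subApp (lam M)  W P = cut (up (lam M)) (app zero (renV suc W) (renT (liftR suc) P))
                                                                    -- C(↑V, y'. y'(...)), y' fresh

mutual
  subT : ∀ {m n} → Sub m n → Tm m → Tm n
  subT σ (up V)      = up (subV σ V)
  subT σ (app x V N) = subApp (σ x) (subV σ V) (subT (liftS σ) N)
  subT σ (cut M N)   = cut (subT σ M) (subT (liftS σ) N)

  subV : ∀ {m n} → Sub m n → Val m → Val n
  subV σ (var x) = σ x
  subV σ (lam M) = lam (subT (liftS σ) M)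

single : ∀ {n} → Val n → Sub (suc n) n
single V zero    = V
single V (suc i) = var i

_[_] : ∀ {n} → Tm (suc n) → Val n → Tm n
N [ V ] = subT (single V) N

-- C(↑(λx.M), y.y(V,z.N)) with y ∉ FV(V) ∪ FV(N): in de Bruijn form,
-- V and N are weakenings (skipping y) of some V₀, N₀.
data BvRedex {n : ℕ} : Val n → Tm (suc n) → Set where
  bv : (M : Tm (suc n)) (V : Val n) (N : Tm (suc n)) →
       BvRedex (lam M) (app zero (renV suc V) (renT (liftR suc) N))

infix 4 _⟶_ _⟶v_
mutual
  data _⟶_ {n : ℕ} : Tm n → Tm n → Set where
    Bv   : (M : Tm (suc n)) (V : Val n) (N : Tm (suc n)) →
           cut (up (lam M)) (app zero (renV suc V) (renT (liftR suc) N))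
             ⟶ cut (cut (up V) M) N
    σv   : (V : Val n) (N : Tm (suc n)) → ¬ BvRedex V N →
           cut (up V) N ⟶ N [ V ]
    ηcut : (M : Tm n) → cut M (up (var zero)) ⟶ M
    π₁   : (z : Fin n) (V : Val n) (P : Tm (suc n)) (N : Tm (suc n)) →
           cut (app z V P) N ⟶ app z V (cut P (renT (liftR suc) N))
    π₂   : (M : Tm n) (P : Tm (suc n)) (N : Tm (suc n)) →
           cut (cut M P) N ⟶ cut M (cut P (renT (liftR suc) N))
    ξup   : ∀ {V V'} → V ⟶v V' → up V ⟶ up V'
    ξappV : ∀ {x V V' N} → V ⟶v V' → app x V N ⟶ app x V' N
    ξappN : ∀ {x V N N'} → N ⟶ N' → app x V N ⟶ app x V N'
    ξcutM : ∀ {M M' N} → M ⟶ M' → cut M N ⟶ cut M' N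
    ξcutN : ∀ {M N N'} → N ⟶ N' → cut M N ⟶ cut M N'

  data _⟶v_ {n : ℕ} : Val n → Val n → Set where
    ξlam : ∀ {M M'} → M ⟶ M' → lam M ⟶v lam M'

infix 4 _⟶*_
_⟶*_ : ∀ {n} → Tm n → Tm n → Set
_⟶*_ = Star _⟶_

-- LNF syntax
--   M,N ::= ↑V | x(V,y.N) | Cv(V,x.N)      V,W ::= x | λx.M

mutual
  data LTm (n : ℕ) : Set where
    lup  : LVal n → LTm n
    lapp : Fin n → LVal n → LTm (suc n) → LTm n
    lcut : LVal n → LTm (suc n) → LTm n

  data LVal (n : ℕ) : Set where
    lvar : Fin n → LVal n
    llam : LTm (suc n) → LVal n

mutual
  lrenT : ∀ {m n} → Ren m n → LTm m → LTm n
  lrenT ρ (lup V)      = lup (lrenV ρ V)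
  lrenT ρ (lapp x V N) = lapp (ρ x) (lrenV ρ V) (lrenT (liftR ρ) N)
  lrenT ρ (lcut V N)   = lcut (lrenV ρ V) (lrenT (liftR ρ) N)

  lrenV : ∀ {m n} → Ren m n → LVal m → LVal n
  lrenV ρ (lvar x) = lvar (ρ x)
  lrenV ρ (llam M) = llam (lrenT (liftR ρ) M)

mutual
  embT : ∀ {n} → LTm n → Tm n
  embT (lup V)      = up (embV V)
  embT (lapp x V N) = app x (embV V) (embT N)
  embT (lcut V N)   = cut (up (embV V)) (embT N)

  embV : ∀ {n} → LVal n → Val n
  embV (lvar x) = var x
  embV (llam M) = lam (embT M)

-- substitution in LNF: the λQ one read through the identification
LSub : ℕ → ℕ → Set
LSub m n = Fin m → LVal n

lliftS : ∀ {m n} → LSub m n → LSub (suc m) (suc n)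
lliftS σ zero    = lvar zero
lliftS σ (suc i) = lrenV suc (σ i)

lsubApp : ∀ {n} → LVal n → LVal n → LTm (suc n) → LTm n
lsubApp (lvar x') W P = lapp x' W P
lsubApp (llam M)  W P = lcut (llam M) (lapp zero (lrenV suc W) (lrenT (liftR suc) P))

mutual
  lsubT : ∀ {m n} → LSub m n → LTm m → LTm n
  lsubT σ (lup V)      = lup (lsubV σ V)
  lsubT σ (lapp x V N) = lsubApp (σ x) (lsubV σ V) (lsubT (lliftS σ) N)
  lsubT σ (lcut V N)   = lcut (lsubV σ V) (lsubT (lliftS σ) N)

  lsubV : ∀ {m n} → LSub m n → LVal m → LVal n
  lsubV σ (lvar x) = σ x
  lsubV σ (llam M) = llam (lsubT (lliftS σ) M)

lsingle : ∀ {n} → LVal n → LSub (suc n) n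
lsingle V zero    = V
lsingle V (suc i) = lvar i

_L[_] : ∀ {n} → LTm (suc n) → LVal n → LTm n
N L[ V ] = lsubT (lsingle V) N

dcut : ∀ {n} → LTm n → LTm (suc n) → LTm n
dcut (lup V)      N = lcut V N
dcut (lapp x V M) N = lapp x V (dcut M (lrenT (liftR suc) N))
dcut (lcut V M)   N = lcut V (dcut M (lrenT (liftR suc) N))

data LBvRedex {n : ℕ} : LVal n → LTm (suc n) → Set where
  lbv : (M : LTm (suc n)) (V : LVal n) (N : LTm (suc n)) →
        LBvRedex (llam M) (lapp zero (lrenV suc V) (lrenT (liftR suc) N))

infix 4 _⟶L_ _⟶Lv_
mutual
  data _⟶L_ {n : ℕ} : LTm n → LTm n → Set where
    LBv   : (M : LTm (suc n)) (V : LVal n) (N : LTm (suc n)) →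
            lcut (llam M) (lapp zero (lrenV suc V) (lrenT (liftR suc) N))
              ⟶L lcut V (dcut M (lrenT (liftR suc) N))
    Lσv   : (V : LVal n) (N : LTm (suc n)) → ¬ LBvRedex V N →
            lcut V N ⟶L N L[ V ]
    ξlup   : ∀ {V V'} → V ⟶Lv V' → lup V ⟶L lup V'
    ξlappV : ∀ {x V V' N} → V ⟶Lv V' → lapp x V N ⟶L lapp x V' N
    ξlappN : ∀ {x V N N'} → N ⟶L N' → lapp x V N ⟶L lapp x V N'
    ξlcutV : ∀ {V V' N} → V ⟶Lv V' → lcut V N ⟶L lcut V' N
    ξlcutN : ∀ {V N N'} → N ⟶L N' → lcut V N ⟶L lcut V N'

  data _⟶Lv_ {n : ℕ} : LVal n → LVal n → Set where
    ξllam : ∀ {M M'} → M ⟶L M' → llam M ⟶Lv llam M'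

infix 4 _⟶L*_
_⟶L*_ : ∀ {n} → LTm n → LTm n → Set
_⟶L*_ = Star _⟶L_

mutual
  ▽ : ∀ {n} → Tm n → LTm n
  ▽ (up V)      = lup (▽▽ V)
  ▽ (app x V N) = lapp x (▽▽ V) (▽ N)
  ▽ (cut M N)   = dcut (▽ M) (▽ N)

  ▽▽ : ∀ {n} → Val n → LVal n
  ▽▽ (var x) = lvar x
  ▽▽ (lam M) = llam (▽ M)

module Submission where

-- The derived cut Cv(M : z.N) is exactly what π₁ and π₂ compute from
-- C(M, z.N); hence LNF steps are simulated in λQ, and ▽ is a λQ-reduction
-- which is the identity on LNF terms.  In the other direction ▽ commutes
-- with renaming, substitution and derived cut, and derived cut is
-- associative, so every λQ rule is mapped to an LNF reduction (π₁ and π₂ to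
-- the empty one).  The side condition "not a Bv-redex" never obstructs:
-- when Cv(V, y.N) is a Bv-redex, [V/y]N = Cv(V, y.N) by the non-homomorphic
-- clause of substitution, so σ-reducing it needs no step at all; and ▽ maps
-- Bv-redexes to Bv-redexes, whence by ▽ ∘ embT = id the embedding reflects
-- them.

open import Defs
open import Data.Nat using (ℕ; suc)
open import Data.Fin using (Fin; zero; suc)
open import Data.Product using (_×_; _,_; ∃)
open import Relation.Nullary using (Dec; yes; no)
open import Relation.Binary.PropositionalEquality hiding ([_])
open import Relation.Binary.Construct.Closure.ReflexiveTransitive
  using (ε; _◅_; _◅◅_; gmap; return; kleisliStar)

private variable k m n : ℕ

cong₃ : ∀ {a b c d} {A : Set a} {B : Set b} {C : Set c} {D : Set d}
        (f : A → B → C → D) {x y u v s t} → x ≡ y → u ≡ v → s ≡ t → f x u s ≡ f y v t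
cong₃ f refl refl refl = refl

-- Renaming and substitution in LNF

liftR-∘ : {ρ : Ren k n} {ρ' : Ren m k} {ρ'' : Ren m n} →
          (∀ i → ρ (ρ' i) ≡ ρ'' i) → ∀ i → liftR ρ (liftR ρ' i) ≡ liftR ρ'' i
liftR-∘ h zero    = refl
liftR-∘ h (suc i) = cong suc (h i)

mutual
  lrenT-∘ : {ρ : Ren k n} {ρ' : Ren m k} {ρ'' : Ren m n} →
            (∀ i → ρ (ρ' i) ≡ ρ'' i) → (M : LTm m) → lrenT ρ (lrenT ρ' M) ≡ lrenT ρ'' M
  lrenT-∘ h (lup V)      = cong lup (lrenV-∘ h V)
  lrenT-∘ h (lapp x V N) = cong₃ lapp (h x) (lrenV-∘ h V) (lrenT-∘ (liftR-∘ h) N)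
  lrenT-∘ h (lcut V N)   = cong₂ lcut (lrenV-∘ h V) (lrenT-∘ (liftR-∘ h) N)

  lrenV-∘ : {ρ : Ren k n} {ρ' : Ren m k} {ρ'' : Ren m n} →
            (∀ i → ρ (ρ' i) ≡ ρ'' i) → (V : LVal m) → lrenV ρ (lrenV ρ' V) ≡ lrenV ρ'' V
  lrenV-∘ h (lvar x) = cong lvar (h x)
  lrenV-∘ h (llam M) = cong llam (lrenT-∘ (liftR-∘ h) M)

lrenV-suc : (ρ : Ren m n) (V : LVal m) → lrenV (liftR ρ) (lrenV suc V) ≡ lrenV suc (lrenV ρ V)
lrenV-suc ρ V = trans (lrenV-∘ (λ _ → refl) V) (sym (lrenV-∘ (λ _ → refl) V))

lrenT-liftR-suc : (ρ : Ren m n) (B : LTm (suc m)) →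
  lrenT (liftR (liftR ρ)) (lrenT (liftR suc) B) ≡ lrenT (liftR suc) (lrenT (liftR ρ) B)
lrenT-liftR-suc ρ B = trans (lrenT-∘ commute B) (sym (lrenT-∘ (λ _ → refl) B))
  where
  commute : ∀ i → liftR (liftR ρ) (liftR suc i) ≡ liftR suc (liftR ρ i)
  commute zero    = refl
  commute (suc i) = refl

lliftS-id : {σ : LSub n n} → (∀ i → σ i ≡ lvar i) → ∀ i → lliftS σ i ≡ lvar i
lliftS-id h zero    = refl
lliftS-id h (suc i) = cong (lrenV suc) (h i)

mutual
  lsubT-id : {σ : LSub n n} → (∀ i → σ i ≡ lvar i) → (M : LTm n) → lsubT σ M ≡ M
  lsubT-id h (lup V)      = cong lup (lsubV-id h V)
  lsubT-id h (lapp x V N) rewrite h x = cong₂ (lapp x) (lsubV-id h V) (lsubT-id (lliftS-id h) N)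
  lsubT-id h (lcut V N)   = cong₂ lcut (lsubV-id h V) (lsubT-id (lliftS-id h) N)

  lsubV-id : {σ : LSub n n} → (∀ i → σ i ≡ lvar i) → (V : LVal n) → lsubV σ V ≡ V
  lsubV-id h (lvar x) = h x
  lsubV-id h (llam M) = cong llam (lsubT-id (lliftS-id h) M)

lliftS-liftR : {σ : LSub k n} {ρ : Ren m k} {σ' : LSub m n} →
               (∀ i → σ (ρ i) ≡ σ' i) → ∀ i → lliftS σ (liftR ρ i) ≡ lliftS σ' i
lliftS-liftR h zero    = refl
lliftS-liftR h (suc i) = cong (lrenV suc) (h i)

mutual
  lsubT-lrenT : {σ : LSub k n} {ρ : Ren m k} {σ' : LSub m n} →
                (∀ i → σ (ρ i) ≡ σ' i) → (M : LTm m) → lsubT σ (lrenT ρ M) ≡ lsubT σ' M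
  lsubT-lrenT h (lup V)      = cong lup (lsubV-lrenV h V)
  lsubT-lrenT h (lapp x V N) = cong₃ lsubApp (h x) (lsubV-lrenV h V) (lsubT-lrenT (lliftS-liftR h) N)
  lsubT-lrenT h (lcut V N)   = cong₂ lcut (lsubV-lrenV h V) (lsubT-lrenT (lliftS-liftR h) N)

  lsubV-lrenV : {σ : LSub k n} {ρ : Ren m k} {σ' : LSub m n} →
                (∀ i → σ (ρ i) ≡ σ' i) → (V : LVal m) → lsubV σ (lrenV ρ V) ≡ lsubV σ' V
  lsubV-lrenV h (lvar x) = h x
  lsubV-lrenV h (llam M) = cong llam (lsubT-lrenT (lliftS-liftR h) M)

lsubT-lrenT-id : {σ : LSub k n} {ρ : Ren n k} →
                 (∀ i → σ (ρ i) ≡ lvar i) → (M : LTm n) → lsubT σ (lrenT ρ M) ≡ M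
lsubT-lrenT-id h M = trans (lsubT-lrenT h M) (lsubT-id (λ _ → refl) M)

lsubV-lrenV-id : {σ : LSub k n} {ρ : Ren n k} →
                 (∀ i → σ (ρ i) ≡ lvar i) → (V : LVal n) → lsubV σ (lrenV ρ V) ≡ V
lsubV-lrenV-id h V = trans (lsubV-lrenV h V) (lsubV-id (λ _ → refl) V)

lrenT-lsubApp : (ρ : Ren m n) (U W : LVal m) (P : LTm (suc m)) →
  lrenT ρ (lsubApp U W P) ≡ lsubApp (lrenV ρ U) (lrenV ρ W) (lrenT (liftR ρ) P)
lrenT-lsubApp ρ (lvar x) W P = refl
lrenT-lsubApp ρ (llam M) W P =
  cong₂ (λ W' P' → lcut (llam (lrenT (liftR ρ) M)) (lapp zero W' P'))
        (lrenV-suc ρ W) (lrenT-liftR-suc ρ P)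

lrenV-lliftS : {ρ : Ren k n} {σ : LSub m k} {σ' : LSub m n} →
               (∀ i → lrenV ρ (σ i) ≡ σ' i) →
               ∀ i → lrenV (liftR ρ) (lliftS σ i) ≡ lliftS σ' i
lrenV-lliftS h zero = refl
lrenV-lliftS {ρ = ρ} {σ = σ} h (suc i) = trans (lrenV-suc ρ (σ i)) (cong (lrenV suc) (h i))

mutual
  lrenT-lsubT : {ρ : Ren k n} {σ : LSub m k} {σ' : LSub m n} →
                (∀ i → lrenV ρ (σ i) ≡ σ' i) → (M : LTm m) → lrenT ρ (lsubT σ M) ≡ lsubT σ' M
  lrenT-lsubT h (lup V) = cong lup (lrenV-lsubV h V)
  lrenT-lsubT {ρ = ρ} {σ = σ} h (lapp x V N) =
    trans (lrenT-lsubApp ρ (σ x) _ _)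
          (cong₃ lsubApp (h x) (lrenV-lsubV h V) (lrenT-lsubT (lrenV-lliftS h) N))
  lrenT-lsubT h (lcut V N) = cong₂ lcut (lrenV-lsubV h V) (lrenT-lsubT (lrenV-lliftS h) N)

  lrenV-lsubV : {ρ : Ren k n} {σ : LSub m k} {σ' : LSub m n} →
                (∀ i → lrenV ρ (σ i) ≡ σ' i) → (V : LVal m) → lrenV ρ (lsubV σ V) ≡ lsubV σ' V
  lrenV-lsubV h (lvar x) = h x
  lrenV-lsubV h (llam M) = cong llam (lrenT-lsubT (lrenV-lliftS h) M)

lsubT-liftR-suc : (σ : LSub m n) (B : LTm (suc m)) →
  lsubT (lliftS (lliftS σ)) (lrenT (liftR suc) B) ≡ lrenT (liftR suc) (lsubT (lliftS σ) B)
lsubT-liftR-suc {m} {n} σ B = trans (lsubT-lrenT {σ' = τ} left B) (sym (lrenT-lsubT right B))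
  where
  τ : LSub (suc m) (suc (suc n))
  τ zero    = lvar zero
  τ (suc j) = lrenV suc (lrenV suc (σ j))
  left : ∀ i → lliftS (lliftS σ) (liftR suc i) ≡ τ i
  left zero    = refl
  left (suc j) = refl
  right : ∀ i → lrenV (liftR suc) (lliftS σ i) ≡ τ i
  right zero    = refl
  right (suc j) = lrenV-suc suc (σ j)

lrenT-L[] : (ρ : Ren m n) (V : LVal m) (N : LTm (suc m)) →
            lrenT ρ (N L[ V ]) ≡ lrenT (liftR ρ) N L[ lrenV ρ V ]
lrenT-L[] ρ V N = trans (lrenT-lsubT (λ _ → refl) N) (sym (lsubT-lrenT singles N))
  where
  singles : ∀ i → lsingle (lrenV ρ V) (liftR ρ i) ≡ lrenV ρ (lsingle V i)
  singles zero    = refl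
  singles (suc j) = refl

-- Derived cut

mutual
  lrenT-dcut : (ρ : Ren m n) (A : LTm m) (B : LTm (suc m)) →
               lrenT ρ (dcut A B) ≡ dcut (lrenT ρ A) (lrenT (liftR ρ) B)
  lrenT-dcut ρ (lup V)      B = refl
  lrenT-dcut ρ (lapp x V M) B = cong (lapp (ρ x) (lrenV ρ V)) (lrenT-dcut-wk ρ M B)
  lrenT-dcut ρ (lcut V M)   B = cong (lcut (lrenV ρ V)) (lrenT-dcut-wk ρ M B)

  lrenT-dcut-wk : (ρ : Ren m n) (M B : LTm (suc m)) →
    lrenT (liftR ρ) (dcut M (lrenT (liftR suc) B))
      ≡ dcut (lrenT (liftR ρ) M) (lrenT (liftR suc) (lrenT (liftR ρ) B))
  lrenT-dcut-wk ρ M B =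
    trans (lrenT-dcut (liftR ρ) M (lrenT (liftR suc) B)) (cong (dcut _) (lrenT-liftR-suc ρ B))

dcut-assoc : (A : LTm n) (B : LTm (suc n)) (C : LTm (suc n)) →
             dcut (dcut A B) C ≡ dcut A (dcut B (lrenT (liftR suc) C))
dcut-assoc (lup V)      B C = refl
dcut-assoc (lapp x V M) B C =
  cong (lapp x V) (trans (dcut-assoc M _ _) (cong (dcut M) (sym (lrenT-dcut-wk suc B C))))
dcut-assoc (lcut V M)   B C =
  cong (lcut V) (trans (dcut-assoc M _ _) (cong (dcut M) (sym (lrenT-dcut-wk suc B C))))

dcut-lsubApp : (U W : LVal n) (P : LTm (suc n)) (B : LTm (suc n)) →
               dcut (lsubApp U W P) B ≡ lsubApp U W (dcut P (lrenT (liftR suc) B))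
dcut-lsubApp (lvar x) W P B = refl
dcut-lsubApp (llam K) W P B =
  cong (λ X → lcut (llam K) (lapp zero (lrenV suc W) X)) (sym (lrenT-dcut-wk suc P B))

mutual
  lsubT-dcut : (σ : LSub m n) (A : LTm m) (B : LTm (suc m)) →
               lsubT σ (dcut A B) ≡ dcut (lsubT σ A) (lsubT (lliftS σ) B)
  lsubT-dcut σ (lup V)      B = refl
  lsubT-dcut σ (lapp x V M) B =
    trans (cong (lsubApp (σ x) (lsubV σ V)) (lsubT-dcut-wk σ M B))
          (sym (dcut-lsubApp (σ x) (lsubV σ V) _ _))
  lsubT-dcut σ (lcut V M)   B = cong (lcut (lsubV σ V)) (lsubT-dcut-wk σ M B)

  lsubT-dcut-wk : (σ : LSub m n) (M B : LTm (suc m)) →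
    lsubT (lliftS σ) (dcut M (lrenT (liftR suc) B))
      ≡ dcut (lsubT (lliftS σ) M) (lrenT (liftR suc) (lsubT (lliftS σ) B))
  lsubT-dcut-wk σ M B =
    trans (lsubT-dcut (lliftS σ) M (lrenT (liftR suc) B)) (cong (dcut _) (lsubT-liftR-suc σ B))

dcut-wk-L[] : (V : LVal n) (N C : LTm (suc n)) →
              dcut N (lrenT (liftR suc) C) L[ V ] ≡ dcut (N L[ V ]) C
dcut-wk-L[] V N C = trans (lsubT-dcut (lsingle V) N _) (cong (dcut _) (lsubT-lrenT-id cancel C))
  where
  cancel : ∀ i → lliftS (lsingle V) (liftR suc i) ≡ lvar i
  cancel zero    = refl
  cancel (suc j) = refl

-- Bv-redexes and reduction in LNF

LBvRedex-L[] : {V : LVal n} {N : LTm (suc n)} → LBvRedex V N → N L[ V ] ≡ lcut V N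
LBvRedex-L[] (lbv K W Q) =
  cong₂ (λ W' Q' → lcut (llam K) (lapp zero (lrenV suc W') (lrenT (liftR suc) Q')))
        (lsubV-lrenV-id (λ _ → refl) W) (lsubT-lrenT-id cancel Q)
  where
  cancel : ∀ i → lliftS (lsingle (llam K)) (liftR suc i) ≡ lvar i
  cancel zero    = refl
  cancel (suc j) = refl

DecImage : Ren m n → Set
DecImage {m} {n} ρ = (y : Fin n) → Dec (∃ λ x → ρ x ≡ y)

suc-DecImage : DecImage {n} suc
suc-DecImage zero    = no λ { (_ , ()) }
suc-DecImage (suc y) = yes (y , refl)

liftR-DecImage : {ρ : Ren m n} → DecImage ρ → DecImage (liftR ρ)
liftR-DecImage d zero = yes (zero , refl)
liftR-DecImage d (suc y) with d y
... | yes (x , refl) = yes (suc x , refl)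
... | no ¬p = no λ { (suc x , refl) → ¬p (x , refl) }

mutual
  decImageT : {ρ : Ren m n} → DecImage ρ → (P : LTm n) → Dec (∃ λ Q → lrenT ρ Q ≡ P)
  decImageT d (lup V) with decImageV d V
  ... | yes (W , refl) = yes (lup W , refl)
  ... | no ¬w = no λ { (lup W , refl) → ¬w (W , refl) }
  decImageT d (lapp y V N) with d y | decImageV d V | decImageT (liftR-DecImage d) N
  ... | yes (x , refl) | yes (W , refl) | yes (Q , refl) = yes (lapp x W Q , refl)
  ... | no ¬x | _ | _ = no λ { (lapp x _ _ , refl) → ¬x (x , refl) }
  ... | _ | no ¬w | _ = no λ { (lapp _ W _ , refl) → ¬w (W , refl) }
  ... | _ | _ | no ¬q = no λ { (lapp _ _ Q , refl) → ¬q (Q , refl) }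
  decImageT d (lcut V N) with decImageV d V | decImageT (liftR-DecImage d) N
  ... | yes (W , refl) | yes (Q , refl) = yes (lcut W Q , refl)
  ... | no ¬w | _ = no λ { (lcut W _ , refl) → ¬w (W , refl) }
  ... | _ | no ¬q = no λ { (lcut _ Q , refl) → ¬q (Q , refl) }

  decImageV : {ρ : Ren m n} → DecImage ρ → (P : LVal n) → Dec (∃ λ Q → lrenV ρ Q ≡ P)
  decImageV d (lvar y) with d y
  ... | yes (x , refl) = yes (lvar x , refl)
  ... | no ¬x = no λ { (lvar x , refl) → ¬x (x , refl) }
  decImageV d (llam M) with decImageT (liftR-DecImage d) M
  ... | yes (Q , refl) = yes (llam Q , refl)
  ... | no ¬q = no λ { (llam Q , refl) → ¬q (Q , refl) }

decLBvRedex : (V : LVal n) (N : LTm (suc n)) → Dec (LBvRedex V N)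
decLBvRedex (lvar x) N                  = no λ ()
decLBvRedex (llam K) (lup _)            = no λ ()
decLBvRedex (llam K) (lcut _ _)         = no λ ()
decLBvRedex (llam K) (lapp (suc x) _ _) = no λ ()
decLBvRedex (llam K) (lapp zero W P)
  with decImageV suc-DecImage W | decImageT (liftR-DecImage suc-DecImage) P
... | yes (W₀ , refl) | yes (P₀ , refl) = yes (lbv K W₀ P₀)
... | no ¬w | _ = no λ { (lbv _ W₀ _) → ¬w (W₀ , refl) }
... | _ | no ¬p = no λ { (lbv _ _ P₀) → ¬p (P₀ , refl) }

lcut⟶*L[] : (V : LVal n) (N : LTm (suc n)) → lcut V N ⟶L* N L[ V ]
lcut⟶*L[] V N with decLBvRedex V N
... | yes r rewrite LBvRedex-L[] r = ε
... | no ¬r = return (Lσv V N ¬r)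

lrenT-⟶L : (ρ : Ren m n) {M M' : LTm m} → M ⟶L M' → lrenT ρ M ⟶L* lrenT ρ M'
lrenT-⟶L ρ (LBv M V N)
  rewrite lrenV-suc ρ V | lrenT-liftR-suc ρ N | lrenT-dcut-wk ρ M N
  = return (LBv (lrenT (liftR ρ) M) (lrenV ρ V) (lrenT (liftR ρ) N))
lrenT-⟶L ρ (Lσv V N _) rewrite lrenT-L[] ρ V N = lcut⟶*L[] _ _
lrenT-⟶L ρ (ξlup (ξllam s)) =
  gmap (λ X → lup (llam X)) (λ s → ξlup (ξllam s)) (lrenT-⟶L (liftR ρ) s)
lrenT-⟶L ρ (ξlappV (ξllam s)) =
  gmap (λ X → lapp _ (llam X) _) (λ s → ξlappV (ξllam s)) (lrenT-⟶L (liftR ρ) s)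
lrenT-⟶L ρ (ξlappN s) = gmap (lapp _ _) ξlappN (lrenT-⟶L (liftR ρ) s)
lrenT-⟶L ρ (ξlcutV (ξllam s)) =
  gmap (λ X → lcut (llam X) _) (λ s → ξlcutV (ξllam s)) (lrenT-⟶L (liftR ρ) s)
lrenT-⟶L ρ (ξlcutN s) = gmap (lcut _) ξlcutN (lrenT-⟶L (liftR ρ) s)

lrenT-⟶L* : (ρ : Ren m n) {M M' : LTm m} → M ⟶L* M' → lrenT ρ M ⟶L* lrenT ρ M'
lrenT-⟶L* ρ = kleisliStar (lrenT ρ) (lrenT-⟶L ρ)

dcut-⟶L*ʳ : (A : LTm n) {B B' : LTm (suc n)} → B ⟶L* B' → dcut A B ⟶L* dcut A B'
dcut-⟶L*ʳ (lup V)      ss = gmap (lcut V) ξlcutN ss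
dcut-⟶L*ʳ (lapp x V M) ss = gmap (lapp x V) ξlappN (dcut-⟶L*ʳ M (lrenT-⟶L* (liftR suc) ss))
dcut-⟶L*ʳ (lcut V M)   ss = gmap (lcut V) ξlcutN (dcut-⟶L*ʳ M (lrenT-⟶L* (liftR suc) ss))

dcut-⟶Lˡ : {A A' : LTm n} → A ⟶L A' → (C : LTm (suc n)) → dcut A C ⟶L* dcut A' C
dcut-⟶Lˡ (LBv M V N) C
  rewrite dcut-assoc M (lrenT (liftR suc) N) (lrenT (liftR suc) C) | sym (lrenT-dcut-wk suc N C)
  = return (LBv M V (dcut N (lrenT (liftR suc) C)))
dcut-⟶Lˡ (Lσv V N _) C rewrite sym (dcut-wk-L[] V N C) = lcut⟶*L[] V _
dcut-⟶Lˡ (ξlup s)    C = return (ξlcutV s)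
dcut-⟶Lˡ (ξlappV s)  C = return (ξlappV s)
dcut-⟶Lˡ (ξlappN s)  C = gmap (lapp _ _) ξlappN (dcut-⟶Lˡ s _)
dcut-⟶Lˡ (ξlcutV s)  C = return (ξlcutV s)
dcut-⟶Lˡ (ξlcutN s)  C = gmap (lcut _) ξlcutN (dcut-⟶Lˡ s _)

dcut-ηcut : (A : LTm n) → dcut A (lup (lvar zero)) ⟶L* A
dcut-ηcut (lup V)      = return (Lσv V (lup (lvar zero)) λ ())
dcut-ηcut (lapp x V M) = gmap (lapp x V) ξlappN (dcut-ηcut M)
dcut-ηcut (lcut V M)   = gmap (lcut V) ξlcutN (dcut-ηcut M)

-- The map ▽ and the embedding

mutual
  ▽-renT : (ρ : Ren m n) (M : Tm m) → ▽ (renT ρ M) ≡ lrenT ρ (▽ M)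
  ▽-renT ρ (up V)      = cong lup (▽▽-renV ρ V)
  ▽-renT ρ (app x V N) = cong₂ (lapp (ρ x)) (▽▽-renV ρ V) (▽-renT (liftR ρ) N)
  ▽-renT ρ (cut M N)   =
    trans (cong₂ dcut (▽-renT ρ M) (▽-renT (liftR ρ) N)) (sym (lrenT-dcut ρ (▽ M) (▽ N)))

  ▽▽-renV : (ρ : Ren m n) (V : Val m) → ▽▽ (renV ρ V) ≡ lrenV ρ (▽▽ V)
  ▽▽-renV ρ (var x) = refl
  ▽▽-renV ρ (lam M) = cong llam (▽-renT (liftR ρ) M)

▽-subApp : (U W : Val n) (P : Tm (suc n)) → ▽ (subApp U W P) ≡ lsubApp (▽▽ U) (▽▽ W) (▽ P)
▽-subApp (var x) W P = refl
▽-subApp (lam M) W P =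
  cong₂ (λ W' P' → lcut (llam (▽ M)) (lapp zero W' P')) (▽▽-renV suc W) (▽-renT (liftR suc) P)

▽▽-liftS : {σ : Sub m n} {τ : LSub m n} →
           (∀ i → ▽▽ (σ i) ≡ τ i) → ∀ i → ▽▽ (liftS σ i) ≡ lliftS τ i
▽▽-liftS h zero = refl
▽▽-liftS {σ = σ} h (suc i) = trans (▽▽-renV suc (σ i)) (cong (lrenV suc) (h i))

mutual
  ▽-subT : {σ : Sub m n} {τ : LSub m n} →
           (∀ i → ▽▽ (σ i) ≡ τ i) → (M : Tm m) → ▽ (subT σ M) ≡ lsubT τ (▽ M)
  ▽-subT h (up V) = cong lup (▽▽-subV h V)
  ▽-subT {σ = σ} h (app x V N) =
    trans (▽-subApp (σ x) _ _) (cong₃ lsubApp (h x) (▽▽-subV h V) (▽-subT (▽▽-liftS h) N))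
  ▽-subT {τ = τ} h (cut M N) =
    trans (cong₂ dcut (▽-subT h M) (▽-subT (▽▽-liftS h) N)) (sym (lsubT-dcut τ (▽ M) (▽ N)))

  ▽▽-subV : {σ : Sub m n} {τ : LSub m n} →
            (∀ i → ▽▽ (σ i) ≡ τ i) → (V : Val m) → ▽▽ (subV σ V) ≡ lsubV τ (▽▽ V)
  ▽▽-subV h (var x) = h x
  ▽▽-subV h (lam M) = cong llam (▽-subT (▽▽-liftS h) M)

▽-[] : (V : Val n) (N : Tm (suc n)) → ▽ (N [ V ]) ≡ ▽ N L[ ▽▽ V ]
▽-[] V N = ▽-subT singles N
  where
  singles : ∀ i → ▽▽ (single V i) ≡ lsingle (▽▽ V) i
  singles zero    = refl
  singles (suc j) = refl

▽-BvRedex : {V : Val n} {N : Tm (suc n)} → BvRedex V N → LBvRedex (▽▽ V) (▽ N)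
▽-BvRedex (bv M W Q) rewrite ▽▽-renV suc W | ▽-renT (liftR suc) Q = lbv (▽ M) (▽▽ W) (▽ Q)

mutual
  embT-lrenT : (ρ : Ren m n) (M : LTm m) → embT (lrenT ρ M) ≡ renT ρ (embT M)
  embT-lrenT ρ (lup V)      = cong up (embV-lrenV ρ V)
  embT-lrenT ρ (lapp x V N) = cong₂ (app (ρ x)) (embV-lrenV ρ V) (embT-lrenT (liftR ρ) N)
  embT-lrenT ρ (lcut V N)   =
    cong₂ (λ V' N' → cut (up V') N') (embV-lrenV ρ V) (embT-lrenT (liftR ρ) N)

  embV-lrenV : (ρ : Ren m n) (V : LVal m) → embV (lrenV ρ V) ≡ renV ρ (embV V)
  embV-lrenV ρ (lvar x) = refl
  embV-lrenV ρ (llam M) = cong lam (embT-lrenT (liftR ρ) M)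

embT-lsubApp : (U W : LVal n) (P : LTm (suc n)) → embT (lsubApp U W P) ≡ subApp (embV U) (embV W) (embT P)
embT-lsubApp (lvar x) W P = refl
embT-lsubApp (llam M) W P =
  cong₂ (λ W' P' → cut (up (lam (embT M))) (app zero W' P'))
        (embV-lrenV suc W) (embT-lrenT (liftR suc) P)

embV-lliftS : {σ : LSub m n} {τ : Sub m n} →
              (∀ i → embV (σ i) ≡ τ i) → ∀ i → embV (lliftS σ i) ≡ liftS τ i
embV-lliftS h zero = refl
embV-lliftS {σ = σ} h (suc i) = trans (embV-lrenV suc (σ i)) (cong (renV suc) (h i))

mutual
  embT-lsubT : {σ : LSub m n} {τ : Sub m n} →
               (∀ i → embV (σ i) ≡ τ i) → (M : LTm m) → embT (lsubT σ M) ≡ subT τ (embT M)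
  embT-lsubT h (lup V) = cong up (embV-lsubV h V)
  embT-lsubT {σ = σ} h (lapp x V N) =
    trans (embT-lsubApp (σ x) _ _) (cong₃ subApp (h x) (embV-lsubV h V) (embT-lsubT (embV-lliftS h) N))
  embT-lsubT h (lcut V N) =
    cong₂ (λ V' N' → cut (up V') N') (embV-lsubV h V) (embT-lsubT (embV-lliftS h) N)

  embV-lsubV : {σ : LSub m n} {τ : Sub m n} →
               (∀ i → embV (σ i) ≡ τ i) → (V : LVal m) → embV (lsubV σ V) ≡ subV τ (embV V)
  embV-lsubV h (lvar x) = h x
  embV-lsubV h (llam M) = cong lam (embT-lsubT (embV-lliftS h) M)

embT-L[] : (V : LVal n) (N : LTm (suc n)) → embT (N L[ V ]) ≡ embT N [ embV V ]
embT-L[] V N = embT-lsubT singles N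
  where
  singles : ∀ i → embV (lsingle V i) ≡ single (embV V) i
  singles zero    = refl
  singles (suc j) = refl

mutual
  ▽-embT : (M : LTm n) → ▽ (embT M) ≡ M
  ▽-embT (lup V)      = cong lup (▽▽-embV V)
  ▽-embT (lapp x V N) = cong₂ (lapp x) (▽▽-embV V) (▽-embT N)
  ▽-embT (lcut V N)   = cong₂ lcut (▽▽-embV V) (▽-embT N)

  ▽▽-embV : (V : LVal n) → ▽▽ (embV V) ≡ V
  ▽▽-embV (lvar x) = refl
  ▽▽-embV (llam M) = cong llam (▽-embT M)

embT-reflects-BvRedex : {V : LVal n} {N : LTm (suc n)} → BvRedex (embV V) (embT N) → LBvRedex V N
embT-reflects-BvRedex {V = V} {N} r = subst₂ LBvRedex (▽▽-embV V) (▽-embT N) (▽-BvRedex r)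

mutual
  cut⟶*dcut : (A : LTm n) (B : LTm (suc n)) → cut (embT A) (embT B) ⟶* embT (dcut A B)
  cut⟶*dcut (lup V)      B = ε
  cut⟶*dcut (lapp x V M) B = π₁ x _ _ _ ◅ gmap (app x (embV V)) ξappN (cut⟶*dcut-wk M B)
  cut⟶*dcut (lcut V M)   B = π₂ _ _ _ ◅ gmap (cut (up (embV V))) ξcutN (cut⟶*dcut-wk M B)

  cut⟶*dcut-wk : (M B : LTm (suc n)) →
    cut (embT M) (renT (liftR suc) (embT B)) ⟶* embT (dcut M (lrenT (liftR suc) B))
  cut⟶*dcut-wk M B =
    subst (λ X → cut (embT M) X ⟶* embT (dcut M (lrenT (liftR suc) B)))
          (embT-lrenT (liftR suc) B) (cut⟶*dcut M (lrenT (liftR suc) B))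

embT-⟶L : {M N : LTm n} → M ⟶L N → embT M ⟶* embT N
embT-⟶L (LBv M V N) rewrite embV-lrenV suc V | embT-lrenT (liftR suc) N =
  Bv _ _ _ ◅ π₂ _ _ _ ◅ gmap (cut (up (embV V))) ξcutN (cut⟶*dcut-wk M N)
embT-⟶L (Lσv V N ¬r) rewrite embT-L[] V N = return (σv _ _ λ r → ¬r (embT-reflects-BvRedex r))
embT-⟶L (ξlup (ξllam s))   = gmap (λ X → up (lam X)) (λ s → ξup (ξlam s)) (embT-⟶L s)
embT-⟶L (ξlappV (ξllam s)) = gmap (λ X → app _ (lam X) _) (λ s → ξappV (ξlam s)) (embT-⟶L s)
embT-⟶L (ξlappN s)         = gmap (app _ _) ξappN (embT-⟶L s)
embT-⟶L (ξlcutV (ξllam s)) =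
  gmap (λ X → cut (up (lam X)) _) (λ s → ξcutM (ξup (ξlam s))) (embT-⟶L s)
embT-⟶L (ξlcutN s)         = gmap (cut _) ξcutN (embT-⟶L s)

▽-⟶ : {M N : Tm n} → M ⟶ N → ▽ M ⟶L* ▽ N
▽-⟶ (Bv M V N) rewrite ▽▽-renV suc V | ▽-renT (liftR suc) N = return (LBv (▽ M) (▽▽ V) (▽ N))
▽-⟶ (σv V N _) rewrite ▽-[] V N = lcut⟶*L[] (▽▽ V) (▽ N)
▽-⟶ (ηcut M) = dcut-ηcut (▽ M)
▽-⟶ (π₁ z V P N) rewrite ▽-renT (liftR suc) N = ε
▽-⟶ (π₂ M P N) rewrite ▽-renT (liftR suc) N | dcut-assoc (▽ M) (▽ P) (▽ N) = ε
▽-⟶ (ξup (ξlam s))   = gmap (λ X → lup (llam X)) (λ s → ξlup (ξllam s)) (▽-⟶ s)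
▽-⟶ (ξappV (ξlam s)) = gmap (λ X → lapp _ (llam X) _) (λ s → ξlappV (ξllam s)) (▽-⟶ s)
▽-⟶ (ξappN s)        = gmap (lapp _ _) ξlappN (▽-⟶ s)
▽-⟶ (ξcutM {N = N} s) = kleisliStar _ (λ s → dcut-⟶Lˡ s (▽ N)) (▽-⟶ s)
▽-⟶ (ξcutN {M} s)    = dcut-⟶L*ʳ (▽ M) (▽-⟶ s)

mutual
  ⟶*embT▽ : (M : Tm n) → M ⟶* embT (▽ M)
  ⟶*embT▽ (up V)      = ⟶*embV▽▽ up ξup V
  ⟶*embT▽ (app x V N) =
    ⟶*embV▽▽ (λ W → app x W N) ξappV V ◅◅ gmap (app x _) ξappN (⟶*embT▽ N)
  ⟶*embT▽ (cut M N)   =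
    gmap (λ X → cut X N) ξcutM (⟶*embT▽ M) ◅◅
    gmap (cut _) ξcutN (⟶*embT▽ N) ◅◅
    cut⟶*dcut (▽ M) (▽ N)

  ⟶*embV▽▽ : (C : Val n → Tm k) → (∀ {V V'} → V ⟶v V' → C V ⟶ C V') →
             (V : Val n) → C V ⟶* C (embV (▽▽ V))
  ⟶*embV▽▽ C ξ (var x) = ε
  ⟶*embV▽▽ C ξ (lam M) = gmap (λ X → C (lam X)) (λ s → ξ (ξlam s)) (⟶*embT▽ M)

theorem7 :
      (∀ {n : ℕ} {M N : LTm n} → M ⟶L N → embT M ⟶* embT N)
    × (∀ {n : ℕ} {M N : Tm n} → M ⟶ N → ▽ M ⟶L* ▽ N)
    × (∀ {n : ℕ} (M : Tm n) → M ⟶* embT (▽ M))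
    × (∀ {n : ℕ} (M : LTm n) → ▽ (embT M) ≡ M)
theorem7 = embT-⟶L , ▽-⟶ , ⟶*embT▽ , ▽-embT
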